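{- Let $x$ be an internal node of $T$ with children $a$ and $b$, let $d\in\mathbb{N}^+$, let $R\in \mathcal{R}^{d}_{V_x}$ and let $R'\subseteq \overline{V_x}$. Let $(A,A')\in \mathcal{R}^{d}_{V_a}\times \mathcal{R}^{d}_{\overline{V_a}}$ and $(B,B')\in \mathcal{R}^{d}_{V_b}\times \mathcal{R}^{d}_{\overline{V_b}}$ be $d$-$(R,R')$-compatible. Let $\mathcal{A}\subseteq 2^{V_a}$ be such that $X\equiv_{V_a}^{d} A$ for all $X\in \mathcal{A}$, and let $\mathcal{B}\subseteq 2^{V_b}$ be such that $W\equiv_{V_b}^{d} B$ for all $W\in \mathcal{B}$. If $\mathcal{A}'\subseteq \mathcal{A}$ $(a,A')$-represents $\mathcal{A}$ and $\mathcal{B}'\subseteq \mathcal{B}$ $(b,B')$-represents $\mathcal{B}$, then $\mathcal{A}' \otimes \mathcal{B}'$ $(x,R')$-represents $\mathcal{A} \otimes \mathcal{B}$.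
   Context: Fix an $n$-vertex graph $G$ with an ordering of $V(G)$, a weight function $\mathsf{w}:V(G)\to\mathbb{Q}$ (extended additively to sets), $\mathsf{opt}\in\{\min,\max\}$, and a rooted layout $(T,\delta)$ of $G$: $T$ is a rooted binary tree and $\delta$ a bijection between $V(G)$ and the leaves of $T$. For a node $y$ of $T$, $V_y$ is the set of vertices mapped to leaves below $y$ (including $y$), and $\overline{S}:=V(G)\setminus S$. For $S\subseteq V(G)$ and $d\in\mathbb{N}^+$, two sets $X,Y\subseteq S$ are $d$-neighbor equivalent over $S$, written $X\equiv^d_S Y$, if $\min(d,|X\cap N(u)|)=\min(d,|Y\cap N(u)|)$ for all $u\in\overline{S}$. $\mathcal{R}^d_S$ denotes the set of canonical representatives of the classes of $\equiv^d_S$ (for each $X\subseteq S$, the lexicographically smallest minimum-size set equivalent to $X$). For $\mathcal{A},\mathcal{B}\subseteq 2^{V(G)}$, $\mathcal{A}\otimes\mathcal{B}=\emptyset$ if either is empty, and otherwise $\{X\cup Y\mid X\in\mathcal{A},Y\in\mathcal{B}\}$. For $\mathcal{A}\subseteq 2^{V(G)}$ and $Y\subseteq V(G)$, $\mathsf{best}(\mathcal{A},Y):=\mathsf{opt}\{\mathsf{w}(X)\mid X\in\mathcal{A}$ and $G[X\cup Y]$ is connected$\}$ (with $\min\emptyset=+\infty$, $\max\emptyset=-\infty$). For a node $y$ of $T$, $R'\subseteq\overline{V_y}$ and $\mathcal{A},\mathcal{B}\subseteq 2^{V_y}$, $\mathcal{B}$ $(y,R')$-represents $\mathcal{A}$ if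 $\mathsf{best}(\mathcal{A},Y)=\mathsf{best}(\mathcal{B},Y)$ for every $Y\subseteq\overline{V_y}$ with $Y\equiv^1_{\overline{V_y}} R'$. For $x$ internal with children $a,b$ and $R\in\mathcal{R}^d_{V_x}$, the pairs $(A,A')\in \mathcal{R}^{d}_{V_a}\times \mathcal{R}^{d}_{\overline{V_a}}$ and $(B,B')\in \mathcal{R}^{d}_{V_b}\times \mathcal{R}^{d}_{\overline{V_b}}$ are $d$-$(R,R')$-compatible if $A\cup B\equiv^d_{V_x} R$, $A'\equiv^d_{\overline{V_a}} B\cup R'$, and $B'\equiv^d_{\overline{V_b}} A\cup R'$. -}

module Defs where

open import Data.Bool using (Bool; true; false; if_then_else_)
open import Data.Nat as ℕ using (ℕ; zero; suc; _⊓_)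
open import Data.Fin using (Fin; zero; suc; _<_; _≟_)
open import Data.Fin.Subset using (Subset; _∈_; _∉_; _⊆_; ∁; _∪_; _∩_; ∣_∣)
open import Data.Vec using (Vec; []; _∷_; tabulate; lookup)
open import Data.List using (List; []; _∷_; _++_; [_]; length; filter)
open import Relation.Nullary.Decidable using (⌊_⌋)
open import Data.Rational as ℚ using (ℚ; 0ℚ; _+_)
open import Data.Product using (Σ; ∃; _×_; _,_)
open import Data.Sum using (_⊎_)
open import Relation.Binary.PropositionalEquality using (_≡_)
open import Relation.Nullary using (¬_)

-- Graphs on the vertex set Fin n (the ordering of V(G) is the order of Fin n)

record Graph (n : ℕ) : Set where
  field
    adj   : Fin n → Fin n → Bool
    sym   : ∀ u v → adj u v ≡ adj v u
    irrefl : ∀ u → adj u u ≡ false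

open Graph public

N : ∀ {n} → Graph n → Fin n → Subset n
N G u = tabulate (adj G u)

data Reach {n} (G : Graph n) (S : Subset n) : Fin n → Fin n → Set where
  here : ∀ {u} → u ∈ S → Reach G S u u
  step : ∀ {u w v} → u ∈ S → adj G u w ≡ true → Reach G S w v → Reach G S u v

-- G[S] is connected (the empty graph counts as connected)
Connected : ∀ {n} → Graph n → Subset n → Set
Connected G S = ∀ u v → u ∈ S → v ∈ S → Reach G S u v

weight : ∀ {n} → (Fin n → ℚ) → Subset n → ℚ
weight {zero}  w []      = 0ℚ
weight {suc n} w (b ∷ X) = (if b then w zero else 0ℚ) + weight (λ i → w (suc i)) X

NeighEquiv : ∀ {n} → Graph n → ℕ → Subset n → Subset n → Subset n → Set
NeighEquiv G d S X Y =
  ∀ u → u ∉ S → d ⊓ ∣ X ∩ N G u ∣ ≡ d ⊓ ∣ Y ∩ N G u ∣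

-- lexicographic order on subsets w.r.t. the vertex ordering
-- (the least vertex in the symmetric difference belongs to the smaller set)
LexLeq : ∀ {n} → Subset n → Subset n → Set
LexLeq {n} X Y =
  X ≡ Y ⊎ Σ (Fin n) λ i → (i ∈ X) × (i ∉ Y) × (∀ j → j < i → (j ∈ X → j ∈ Y) × (j ∈ Y → j ∈ X))

-- R ∈ 𝓡^d_S : R is the lexicographically smallest minimum-size set
-- that is d-neighbour equivalent over S to R
IsRep : ∀ {n} → Graph n → ℕ → Subset n → Subset n → Set
IsRep G d S R =
  R ⊆ S × (∀ X → X ⊆ S → NeighEquiv G d S X R →
             ∣ R ∣ ℕ.< ∣ X ∣ ⊎ (∣ R ∣ ≡ ∣ X ∣ × LexLeq R X))

Family : ℕ → Set₁
Family n = Subset n → Set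

_⊑_ : ∀ {n} → Family n → Family n → Set
𝒜 ⊑ ℬ = ∀ X → 𝒜 X → ℬ X

_⊗_ : ∀ {n} → Family n → Family n → Family n
(𝒜 ⊗ ℬ) Z = Σ _ λ X → Σ _ λ Y → 𝒜 X × ℬ Y × Z ≡ X ∪ Y

data Opt : Set where
  min max : Opt

data ℚ∞ : Set where
  -∞ : ℚ∞
  fin : ℚ → ℚ∞
  +∞ : ℚ∞

optEmpty : Opt → ℚ∞
optEmpty min = +∞
optEmpty max = -∞

AtLeastAsGood : Opt → ℚ → ℚ → Set
AtLeastAsGood min p q = p ℚ.≤ q
AtLeastAsGood max p q = q ℚ.≤ p

-- IsBest opt G w 𝒜 Y v  :⇔  v = best(𝒜, Y)
--   = opt { w(X) | X ∈ 𝒜, G[X ∪ Y] connected }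
IsBest : ∀ {n} → Opt → Graph n → (Fin n → ℚ) → Family n → Subset n → ℚ∞ → Set
IsBest o G w 𝒜 Y v =
    (v ≡ optEmpty o × (∀ X → 𝒜 X → ¬ Connected G (X ∪ Y)))
  ⊎ (Σ _ λ X → 𝒜 X × Connected G (X ∪ Y) × v ≡ fin (weight w X)
       × (∀ X' → 𝒜 X' → Connected G (X' ∪ Y) → AtLeastAsGood o (weight w X) (weight w X')))

-- Rooted layouts: rooted trees with at most two children per node,
-- leaves labelled by vertices

data Tree (n : ℕ) : Set where
  leaf  : Fin n → Tree n
  node1 : Tree n → Tree n
  node2 : Tree n → Tree n → Tree n

leafList : ∀ {n} → Tree n → List (Fin n)
leafList (leaf v)    = [ v ]
leafList (node1 t)   = leafList t
leafList (node2 l r) = leafList l ++ leafList r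

-- δ is a bijection between V(G) and the leaves of T
IsLayout : ∀ {n} → Tree n → Set
IsLayout {n} T = ∀ (v : Fin n) → length (filter (v ≟_) (leafList T)) ≡ 1

V : ∀ {n} → Tree n → Subset n
V (leaf v)    = tabulate (λ u → ⌊ u ≟ v ⌋)
V (node1 t)   = V t
V (node2 l r) = V l ∪ V r

-- y is a node of T (y is the subtree of T rooted at that node)
data NodeOf {n} : Tree n → Tree n → Set where
  root  : ∀ {t} → NodeOf t t
  in1   : ∀ {y t} → NodeOf y t → NodeOf y (node1 t)
  inl   : ∀ {y l r} → NodeOf y l → NodeOf y (node2 l r)
  inr   : ∀ {y l r} → NodeOf y r → NodeOf y (node2 l r)

Represents : ∀ {n} → Opt → Graph n → (Fin n → ℚ) → Tree n → Subset n →
             Family n → Family n → Set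
Represents o G w y R' ℬ 𝒜 =
  ∀ Y → Y ⊆ ∁ (V y) → NeighEquiv G 1 (∁ (V y)) Y R' →
    ∀ v → (IsBest o G w 𝒜 Y v → IsBest o G w ℬ Y v)
        × (IsBest o G w ℬ Y v → IsBest o G w 𝒜 Y v)

Compatible : ∀ {n} → Graph n → ℕ → Tree n → Tree n →
             Subset n → Subset n → Subset n → Subset n → Subset n → Subset n → Set
Compatible G d a b R R' A A' B B' =
    NeighEquiv G d (V a ∪ V b) (A ∪ B) R
  × NeighEquiv G d (∁ (V a)) A' (B ∪ R')
  × NeighEquiv G d (∁ (V b)) B' (A ∪ R')

module Submission where

-- Fix Y ⊆ ∁ V_x with Y ≡¹ R'.  The heart of the proof is a statement about
-- arbitrary families (module Product): if 𝒜' ⊑ 𝒜 and ℬ' ⊑ ℬ, weights add over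
-- 𝒜 ⊗ ℬ, 𝒜' preserves the best value of 𝒜 relative to W ∪ Y for every W ∈ ℬ and
-- ℬ' preserves the best value of ℬ relative to X ∪ Y for every X ∈ 𝒜, then
-- 𝒜' ⊗ ℬ' and 𝒜 ⊗ ℬ have the same best values relative to Y.  Forwards, an
-- optimum X ∪ W of 𝒜 ⊗ ℬ is traded for X₁ ∪ W with X₁ an optimum of 𝒜' of the
-- same weight, and then for X₁ ∪ W₁ with W₁ an optimum of ℬ'.  Backwards, every
-- connected member of 𝒜 ⊗ ℬ is dominated by one of 𝒜' ⊗ ℬ'.  Families are
-- arbitrary predicates, so optima exist only up to double negation; this
-- suffices because comparing two weights is decidable.
-- The graph-theoretic facts supply the hypotheses: the children of a node of a
-- layout have disjoint vertex sets, so weights add, and d-(R,R')-compatibility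
-- yields W ∪ Y ≡¹ A' over ∁ V_a for W ≡ᵈ B, and symmetrically for b.

open import Defs
open import Data.Nat using (ℕ; _≥_)
open import Data.Fin using (Fin)
open import Data.Fin.Subset using (Subset; _⊆_; ∁)
open import Data.Rational using (ℚ)

open import Algebra.Bundles using (CommutativeMonoid)
open import Data.Bool using (true; false; _∨_; if_then_else_)
import Data.Nat as ℕ
import Data.Nat.Properties as ℕP
import Data.Rational as ℚ
import Data.Rational.Properties as ℚP
open import Data.Fin using (zero; suc; _≟_)
open import Data.Fin.Subset using (_∈_; _∪_; _∩_; ∣_∣)
open import Data.Fin.Subset.Properties
  using (x∈∁p⇒x∉p; x∉p⇒x∈∁p; x∈p∪q⁻; p⊆p∪q; q⊆p∪q;
         p⊆q⇒∁p⊇∁q; drop-∷-⊆; ∪-assoc; ∪-comm; ∩-distribʳ-∪)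
open import Data.Vec using (_∷_; []; here)
open import Data.Vec.Properties using ([]=⇒lookup; lookup∘tabulate)
open import Data.List using (List; []; _∷_; _++_; map; length; filter)
open import Data.List.Properties using (filter-++; length-++)
open import Data.List.Membership.Propositional using () renaming (_∈_ to _∈ˡ_)
open import Data.List.Membership.Propositional.Properties using (∈-map⁺; ∈-++⁺ˡ; ∈-++⁺ʳ)
open import Data.List.Relation.Unary.Any using (here; there)
open import Data.Product using (Σ; _×_; _,_; proj₁)
open import Data.Sum using (_⊎_; inj₁; inj₂)
open import Data.Empty using (⊥; ⊥-elim)
open import Function using (_∘_; case_of_)
open import Relation.Nullary using (¬_; Dec; yes; no)
open import Relation.Nullary.Decidable using (decidable-stable; ⌊_⌋)
open import Relation.Binary.PropositionalEquality
  using (_≡_; refl; trans; cong; cong₂; subst; subst₂; module ≡-Reasoning)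
  renaming (sym to ≡-sym)
open import Algebra.Properties.Group ℚP.+-0-group using (//-rightDividesʳ)
open import Algebra.Properties.CommutativeSemigroup
  (CommutativeMonoid.commutativeSemigroup ℚP.+-0-commutativeMonoid) using (interchange)

private
  ¬¬_ : Set → Set
  ¬¬ P = ¬ ¬ P

good-refl : ∀ o p → AtLeastAsGood o p p
good-refl min p = ℚP.≤-refl
good-refl max p = ℚP.≤-refl

good-trans : ∀ o {p q r} → AtLeastAsGood o p q → AtLeastAsGood o q r → AtLeastAsGood o p r
good-trans min p≤q q≤r = ℚP.≤-trans p≤q q≤r
good-trans max q≤p r≤q = ℚP.≤-trans r≤q q≤p

good-total : ∀ o p q → AtLeastAsGood o p q ⊎ AtLeastAsGood o q p
good-total min p q = ℚP.≤-total p q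
good-total max p q = ℚP.≤-total q p

-- Decidability is what lets us leave double negation at the end.
good-dec : ∀ o p q → Dec (AtLeastAsGood o p q)
good-dec min p q = p ℚ.≤? q
good-dec max p q = q ℚ.≤? p

good-+ : ∀ o {p q r s} → AtLeastAsGood o p q → AtLeastAsGood o r s →
         AtLeastAsGood o (p ℚ.+ r) (q ℚ.+ s)
good-+ min = ℚP.+-mono-≤
good-+ max = ℚP.+-mono-≤

+-cancelʳ-≤ : ∀ {p q} r → p ℚ.+ r ℚ.≤ q ℚ.+ r → p ℚ.≤ q
+-cancelʳ-≤ {p} {q} r h =
  subst₂ ℚ._≤_ (//-rightDividesʳ r p) (//-rightDividesʳ r q) (ℚP.+-monoˡ-≤ (ℚ.- r) h)

good-cancelʳ : ∀ o {p q} r → AtLeastAsGood o (p ℚ.+ r) (q ℚ.+ r) → AtLeastAsGood o p q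
good-cancelʳ min r = +-cancelʳ-≤ r
good-cancelʳ max r = +-cancelʳ-≤ r

good-cancelˡ : ∀ o {p q} r → AtLeastAsGood o (r ℚ.+ p) (r ℚ.+ q) → AtLeastAsGood o p q
good-cancelˡ o {p} {q} r h =
  good-cancelʳ o r (subst₂ (AtLeastAsGood o) (ℚP.+-comm r p) (ℚP.+-comm r q) h)

fin≢optEmpty : ∀ o {p} → fin p ≡ optEmpty o → ⊥
fin≢optEmpty min ()
fin≢optEmpty max ()

fin-injective : ∀ {p q} → fin p ≡ fin q → p ≡ q
fin-injective refl = refl

module _ {n} (o : Opt) (G : Graph n) (w : Fin n → ℚ) where

  Optimum : Family n → Subset n → Subset n → Set
  Optimum 𝒞 Y X =
    𝒞 X × Connected G (X ∪ Y)
        × (∀ X' → 𝒞 X' → Connected G (X' ∪ Y) → AtLeastAsGood o (weight w X) (weight w X'))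

  NoneConnected : Family n → Subset n → Set
  NoneConnected 𝒞 Y = ∀ X → 𝒞 X → ¬ Connected G (X ∪ Y)

  BestPreserved : Family n → Family n → Subset n → Set
  BestPreserved 𝒞 𝒞' Y = ∀ v → IsBest o G w 𝒞 Y v → IsBest o G w 𝒞' Y v

  Dominated : Family n → Subset n → Subset n → Set
  Dominated 𝒞 Y X =
    ¬¬ (Σ (Subset n) λ X₁ → 𝒞 X₁ × Connected G (X₁ ∪ Y)
                          × AtLeastAsGood o (weight w X₁) (weight w X))

  optimum⇒best : ∀ {𝒞 Y X} → Optimum 𝒞 Y X → IsBest o G w 𝒞 Y (fin (weight w X))
  optimum⇒best {X = X} (x∈ , conn , opt) = inj₂ (X , x∈ , conn , refl , opt)

  best⇒optimum : ∀ {𝒞 Y p} → IsBest o G w 𝒞 Y (fin p) →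
                 Σ (Subset n) λ X → Optimum 𝒞 Y X × weight w X ≡ p
  best⇒optimum (inj₁ (p≡empty , _))             = ⊥-elim (fin≢optEmpty o p≡empty)
  best⇒optimum (inj₂ (X , x∈ , conn , p≡ , opt)) = X , (x∈ , conn , opt) , ≡-sym (fin-injective p≡)

  best-preserved : ∀ {𝒞 𝒞' Y} → (NoneConnected 𝒞 Y → NoneConnected 𝒞' Y) →
    (∀ X → Optimum 𝒞 Y X → Σ (Subset n) λ X₁ → Optimum 𝒞' Y X₁ × weight w X₁ ≡ weight w X) →
    BestPreserved 𝒞 𝒞' Y
  best-preserved none⇒none _ v (inj₁ (v≡ , none)) = inj₁ (v≡ , none⇒none none)
  best-preserved _ opt⇒opt v (inj₂ (X , x∈ , conn , refl , opt))
    with opt⇒opt X (x∈ , conn , opt)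
  ... | X₁ , opt₁ , same = subst (IsBest o G w _ _ ∘ fin) same (optimum⇒best opt₁)

  preserved-optimum : ∀ {𝒞 𝒞' Y X} → BestPreserved 𝒞 𝒞' Y → Optimum 𝒞 Y X →
                      Σ (Subset n) λ X₁ → Optimum 𝒞' Y X₁ × weight w X₁ ≡ weight w X
  preserved-optimum pres opt = best⇒optimum (pres _ (optimum⇒best opt))

  optimum-replace : ∀ {𝒞 Y X X'} → Optimum 𝒞 Y X → 𝒞 X' → Connected G (X' ∪ Y) →
                    weight w X' ≡ weight w X → Optimum 𝒞 Y X'
  optimum-replace {X = X} (_ , _ , opt) x'∈ conn same =
    x'∈ , conn , λ X'' x''∈ conn'' →
      subst (λ q → AtLeastAsGood o q (weight w X'')) (≡-sym same) (opt X'' x''∈ conn'')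

  optimum-restrict : ∀ {𝒞 𝒞' Y X} → 𝒞' ⊑ 𝒞 → 𝒞' X → Optimum 𝒞 Y X → Optimum 𝒞' Y X
  optimum-restrict 𝒞'⊑𝒞 x∈ (_ , conn , opt) =
    x∈ , conn , λ X' x'∈ conn' → opt X' (𝒞'⊑𝒞 X' x'∈) conn'

  dominating-subfamily : ∀ {𝒞 𝒞' Y} → 𝒞' ⊑ 𝒞 →
    (∀ X → 𝒞 X → Connected G (X ∪ Y) → Dominated 𝒞' Y X) → BestPreserved 𝒞' 𝒞 Y
  dominating-subfamily 𝒞'⊑𝒞 dom v (inj₁ (v≡ , none')) =
    inj₁ (v≡ , λ X x∈ conn → dom X x∈ conn λ (X₁ , x₁∈ , conn₁ , _) → none' X₁ x₁∈ conn₁)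
  dominating-subfamily {𝒞} {Y = Y} 𝒞'⊑𝒞 dom v (inj₂ (X , x∈ , conn , v≡ , opt')) =
    inj₂ (X , 𝒞'⊑𝒞 X x∈ , conn , v≡ , beats)
    where
    beats : ∀ X' → 𝒞 X' → Connected G (X' ∪ Y) → AtLeastAsGood o (weight w X) (weight w X')
    beats X' x'∈ conn' = decidable-stable (good-dec o _ _) λ notGood →
      dom X' x'∈ conn' λ (X₁ , x₁∈ , conn₁ , X₁≽X') →
        notGood (good-trans o (opt' X₁ x₁∈ conn₁) X₁≽X')

OptimalInList : ∀ {A : Set} → Opt → (A → ℚ) → (A → Set) → List A → Set
OptimalInList {A} o f P L =
    (∀ X → X ∈ˡ L → ¬ P X)
  ⊎ (Σ A λ X → P X × (∀ X' → X' ∈ˡ L → P X' → AtLeastAsGood o (f X) (f X')))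

excluded-middle : ∀ (P : Set) → ¬¬ (P ⊎ ¬ P)
excluded-middle P k = k (inj₂ λ p → k (inj₁ p))

optimal-cons : ∀ {A : Set} o f (P : A → Set) X L →
  OptimalInList o f P L → P X ⊎ ¬ P X → OptimalInList o f P (X ∷ L)
optimal-cons o f P X L (inj₁ none) (inj₂ ¬pX) =
  inj₁ λ { _ (here refl) → ¬pX ; X' (there m) → none X' m }
optimal-cons o f P X L (inj₁ none) (inj₁ pX) =
  inj₂ (X , pX , λ { _ (here refl) _ → good-refl o (f X) ; X' (there m) pX' → ⊥-elim (none X' m pX') })
optimal-cons o f P X L (inj₂ (Z , pZ , best)) (inj₂ ¬pX) =
  inj₂ (Z , pZ , λ { _ (here refl) pX → ⊥-elim (¬pX pX) ; X' (there m) pX' → best X' m pX' })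
optimal-cons o f P X L (inj₂ (Z , pZ , best)) (inj₁ pX) with good-total o (f X) (f Z)
... | inj₁ X≽Z = inj₂ (X , pX , λ { _ (here refl) _ → good-refl o (f X)
                                    ; X' (there m) pX' → good-trans o X≽Z (best X' m pX') })
... | inj₂ Z≽X = inj₂ (Z , pZ , λ { _ (here refl) _ → Z≽X ; X' (there m) pX' → best X' m pX' })

optimal-in-list : ∀ {A : Set} o f (P : A → Set) L → ¬¬ OptimalInList o f P L
optimal-in-list o f P []      k = k (inj₁ λ _ ())
optimal-in-list o f P (X ∷ L) k =
  optimal-in-list o f P L λ opt → excluded-middle (P X) λ dec → k (optimal-cons o f P X L opt dec)

allSubsets : ∀ n → List (Subset n)
allSubsets ℕ.zero    = [] ∷ []
allSubsets (ℕ.suc n) = map (true ∷_) (allSubsets n) ++ map (false ∷_) (allSubsets n)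

∈-allSubsets : ∀ {n} (X : Subset n) → X ∈ˡ allSubsets n
∈-allSubsets []          = here refl
∈-allSubsets (true ∷ X)  = ∈-++⁺ˡ (∈-map⁺ (true ∷_) (∈-allSubsets X))
∈-allSubsets (false ∷ X) =
  ∈-++⁺ʳ (map (true ∷_) (allSubsets _)) (∈-map⁺ (false ∷_) (∈-allSubsets X))

optimum-or-none : ∀ {n} o G w (𝒞 : Family n) Y →
  ¬¬ (NoneConnected o G w 𝒞 Y ⊎ Σ (Subset n) (Optimum o G w 𝒞 Y))
optimum-or-none {n} o G w 𝒞 Y k =
  optimal-in-list o (weight w) P (allSubsets n) λ
    { (inj₁ none) → k (inj₁ λ X x∈ conn → none X (∈-allSubsets X) (x∈ , conn))
    ; (inj₂ (X , (x∈ , conn) , best)) →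
        k (inj₂ (X , x∈ , conn , λ X' x'∈ conn' → best X' (∈-allSubsets X') (x'∈ , conn'))) }
  where
  P : Subset n → Set
  P X = 𝒞 X × Connected G (X ∪ Y)

preserved⇒dominated : ∀ {n} o G w {𝒞 𝒞' : Family n} {Y X} → BestPreserved o G w 𝒞 𝒞' Y →
  𝒞 X → Connected G (X ∪ Y) → Dominated o G w 𝒞' Y X
preserved⇒dominated o G w {𝒞} {Y = Y} {X} pres x∈ conn k = optimum-or-none o G w 𝒞 Y λ
  { (inj₁ none) → none X x∈ conn
  ; (inj₂ (X₀ , opt₀@(_ , _ , X₀≽))) → case preserved-optimum o G w pres opt₀ of λ
      { (X₁ , (x₁∈ , conn₁ , _) , same) →
          k (X₁ , x₁∈ , conn₁ , subst (λ q → AtLeastAsGood o q (weight w X)) (≡-sym same) (X₀≽ X x∈ conn)) } }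

⊗-mono : ∀ {n} {𝒜 ℬ 𝒜' ℬ' : Family n} → 𝒜' ⊑ 𝒜 → ℬ' ⊑ ℬ → (𝒜' ⊗ ℬ') ⊑ (𝒜 ⊗ ℬ)
⊗-mono 𝒜'⊑𝒜 ℬ'⊑ℬ _ (X , W , x∈ , w∈ , refl) = X , W , 𝒜'⊑𝒜 X x∈ , ℬ'⊑ℬ W w∈ , refl

module Product {n} (o : Opt) (G : Graph n) (w : Fin n → ℚ) (𝒜 ℬ 𝒜' ℬ' : Family n) (Y : Subset n)
  (𝒜'⊑𝒜 : 𝒜' ⊑ 𝒜) (ℬ'⊑ℬ : ℬ' ⊑ ℬ)
  (presA : ∀ W → ℬ W → BestPreserved o G w 𝒜 𝒜' (W ∪ Y))
  (presB : ∀ X → 𝒜 X → BestPreserved o G w ℬ ℬ' (X ∪ Y))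
  (additive : ∀ X W → 𝒜 X → ℬ W → weight w (X ∪ W) ≡ weight w X ℚ.+ weight w W)
  where

  Conn : Subset n → Set
  Conn = Connected G

  assocˡ : ∀ X W → (X ∪ W) ∪ Y ≡ X ∪ (W ∪ Y)
  assocˡ X W = ∪-assoc X W Y

  assocʳ : ∀ X W → (X ∪ W) ∪ Y ≡ W ∪ (X ∪ Y)
  assocʳ X W = trans (cong (_∪ Y) (∪-comm X W)) (∪-assoc W X Y)

  optimum-factorˡ : ∀ {X W} → 𝒜 X → ℬ W → Optimum o G w (𝒜 ⊗ ℬ) Y (X ∪ W) →
                    Optimum o G w 𝒜 (W ∪ Y) X
  optimum-factorˡ {X} {W} x∈ w∈ (_ , conn , opt) =
    x∈ , subst Conn (assocˡ X W) conn , λ X' x'∈ conn' →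
      good-cancelʳ o (weight w W)
        (subst₂ (AtLeastAsGood o) (additive X W x∈ w∈) (additive X' W x'∈ w∈)
          (opt (X' ∪ W) (X' , W , x'∈ , w∈ , refl) (subst Conn (≡-sym (assocˡ X' W)) conn')))

  optimum-factorʳ : ∀ {X W} → 𝒜 X → ℬ W → Optimum o G w (𝒜 ⊗ ℬ) Y (X ∪ W) →
                    Optimum o G w ℬ (X ∪ Y) W
  optimum-factorʳ {X} {W} x∈ w∈ (_ , conn , opt) =
    w∈ , subst Conn (assocʳ X W) conn , λ W' w'∈ conn' →
      good-cancelˡ o (weight w X)
        (subst₂ (AtLeastAsGood o) (additive X W x∈ w∈) (additive X W' x∈ w'∈)
          (opt (X ∪ W') (X , W' , x∈ , w'∈ , refl) (subst Conn (≡-sym (assocʳ X W')) conn')))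

  swap-left : ∀ {X W} → 𝒜 X → ℬ W → Optimum o G w (𝒜 ⊗ ℬ) Y (X ∪ W) →
    Σ (Subset n) λ X₁ → 𝒜' X₁ × Optimum o G w (𝒜 ⊗ ℬ) Y (X₁ ∪ W)
                      × weight w (X₁ ∪ W) ≡ weight w (X ∪ W)
  swap-left {X} {W} x∈ w∈ opt
    with preserved-optimum o G w (presA W w∈) (optimum-factorˡ x∈ w∈ opt)
  ... | X₁ , (x₁∈ , conn₁ , _) , same =
    X₁ , x₁∈ , optimum-replace o G w opt (X₁ , W , 𝒜'⊑𝒜 X₁ x₁∈ , w∈ , refl)
                 (subst Conn (≡-sym (assocˡ X₁ W)) conn₁) weights , weights
    where
    open ≡-Reasoning
    weights : weight w (X₁ ∪ W) ≡ weight w (X ∪ W)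
    weights = begin
      weight w (X₁ ∪ W)              ≡⟨ additive X₁ W (𝒜'⊑𝒜 X₁ x₁∈) w∈ ⟩
      weight w X₁ ℚ.+ weight w W     ≡⟨ cong (ℚ._+ weight w W) same ⟩
      weight w X ℚ.+ weight w W      ≡⟨ additive X W x∈ w∈ ⟨
      weight w (X ∪ W)               ∎

  swap-right : ∀ {X W} → 𝒜 X → ℬ W → Optimum o G w (𝒜 ⊗ ℬ) Y (X ∪ W) →
    Σ (Subset n) λ W₁ → ℬ' W₁ × Optimum o G w (𝒜 ⊗ ℬ) Y (X ∪ W₁)
                      × weight w (X ∪ W₁) ≡ weight w (X ∪ W)
  swap-right {X} {W} x∈ w∈ opt
    with preserved-optimum o G w (presB X x∈) (optimum-factorʳ x∈ w∈ opt)
  ... | W₁ , (w₁∈ , conn₁ , _) , same =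
    W₁ , w₁∈ , optimum-replace o G w opt (X , W₁ , x∈ , ℬ'⊑ℬ W₁ w₁∈ , refl)
                 (subst Conn (≡-sym (assocʳ X W₁)) conn₁) weights , weights
    where
    open ≡-Reasoning
    weights : weight w (X ∪ W₁) ≡ weight w (X ∪ W)
    weights = begin
      weight w (X ∪ W₁)              ≡⟨ additive X W₁ x∈ (ℬ'⊑ℬ W₁ w₁∈) ⟩
      weight w X ℚ.+ weight w W₁     ≡⟨ cong (weight w X ℚ.+_) same ⟩
      weight w X ℚ.+ weight w W      ≡⟨ additive X W x∈ w∈ ⟨
      weight w (X ∪ W)               ∎

  optimum-transfer : ∀ Z → Optimum o G w (𝒜 ⊗ ℬ) Y Z →
    Σ (Subset n) λ Z₁ → Optimum o G w (𝒜' ⊗ ℬ') Y Z₁ × weight w Z₁ ≡ weight w Z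
  optimum-transfer _ opt@((X , W , x∈ , w∈ , refl) , _)
    with swap-left x∈ w∈ opt
  ... | X₁ , x₁∈ , opt₁ , same₁
    with swap-right (𝒜'⊑𝒜 X₁ x₁∈) w∈ opt₁
  ... | W₁ , w₁∈ , opt₂ , same₂ =
    X₁ ∪ W₁ , optimum-restrict o G w (⊗-mono 𝒜'⊑𝒜 ℬ'⊑ℬ) (X₁ , W₁ , x₁∈ , w₁∈ , refl) opt₂
            , trans same₂ same₁

  -- Dominating X by X₁ ∈ 𝒜' relative to W ∪ Y, then W by W₁ ∈ ℬ' relative to
  -- X₁ ∪ Y, dominates X ∪ W by X₁ ∪ W₁.
  product-dominated : ∀ Z → (𝒜 ⊗ ℬ) Z → Conn (Z ∪ Y) → Dominated o G w (𝒜' ⊗ ℬ') Y Z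
  product-dominated _ (X , W , x∈ , w∈ , refl) conn k =
    preserved⇒dominated o G w (presA W w∈) x∈ (subst Conn (assocˡ X W) conn)
      λ (X₁ , x₁∈ , conn₁ , X₁≽X) →
    preserved⇒dominated o G w (presB X₁ (𝒜'⊑𝒜 X₁ x₁∈)) w∈
      (subst Conn (trans (≡-sym (assocˡ X₁ W)) (assocʳ X₁ W)) conn₁)
      λ (W₁ , w₁∈ , conn₂ , W₁≽W) →
    k (X₁ ∪ W₁ , (X₁ , W₁ , x₁∈ , w₁∈ , refl) , subst Conn (≡-sym (assocʳ X₁ W₁)) conn₂ ,
       subst₂ (AtLeastAsGood o)
         (≡-sym (additive X₁ W₁ (𝒜'⊑𝒜 X₁ x₁∈) (ℬ'⊑ℬ W₁ w₁∈))) (≡-sym (additive X W x∈ w∈))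
         (good-+ o X₁≽X W₁≽W))

  forward : BestPreserved o G w (𝒜 ⊗ ℬ) (𝒜' ⊗ ℬ') Y
  forward = best-preserved o G w (λ none Z z∈ → none Z (⊗-mono 𝒜'⊑𝒜 ℬ'⊑ℬ Z z∈)) optimum-transfer

  backward : BestPreserved o G w (𝒜' ⊗ ℬ') (𝒜 ⊗ ℬ) Y
  backward = dominating-subfamily o G w (⊗-mono 𝒜'⊑𝒜 ℬ'⊑ℬ) product-dominated

module _ {n} (G : Graph n) where

  neighEquiv-sym : ∀ {d S X Y} → NeighEquiv G d S X Y → NeighEquiv G d S Y X
  neighEquiv-sym X≡Y u u∉S = ≡-sym (X≡Y u u∉S)

  neighEquiv-trans : ∀ {d S X Y Z} → NeighEquiv G d S X Y → NeighEquiv G d S Y Z →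
                     NeighEquiv G d S X Z
  neighEquiv-trans X≡Y Y≡Z u u∉S = trans (X≡Y u u∉S) (Y≡Z u u∉S)

  -- Equivalence over a larger set tests fewer outside vertices.
  neighEquiv-mono : ∀ {d S S' X Y} → S ⊆ S' → NeighEquiv G d S X Y → NeighEquiv G d S' X Y
  neighEquiv-mono S⊆S' X≡Y u u∉S' = X≡Y u (u∉S' ∘ S⊆S')

  neighEquiv-weaken : ∀ {d S X Y} → d ≥ 1 → NeighEquiv G d S X Y → NeighEquiv G 1 S X Y
  neighEquiv-weaken {d} {X = X} {Y} d≥1 X≡Y u u∉S = begin
    1 ℕ.⊓ ∣ X ∩ N G u ∣             ≡⟨ cap ∣ X ∩ N G u ∣ ⟨
    1 ℕ.⊓ (d ℕ.⊓ ∣ X ∩ N G u ∣)     ≡⟨ cong (1 ℕ.⊓_) (X≡Y u u∉S) ⟩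
    1 ℕ.⊓ (d ℕ.⊓ ∣ Y ∩ N G u ∣)     ≡⟨ cap ∣ Y ∩ N G u ∣ ⟩
    1 ℕ.⊓ ∣ Y ∩ N G u ∣             ∎
    where
    open ≡-Reasoning
    cap : ∀ m → 1 ℕ.⊓ (d ℕ.⊓ m) ≡ 1 ℕ.⊓ m
    cap m = trans (≡-sym (ℕP.⊓-assoc 1 d m)) (cong (ℕ._⊓ m) (ℕP.m≤n⇒m⊓n≡m d≥1))

-- Whether a union is nonempty is decided by whether either part is.
∣∪∣-capped : ∀ {n} (P Q : Subset n) → 1 ℕ.⊓ ∣ P ∪ Q ∣ ≡ (1 ℕ.⊓ ∣ P ∣) ℕ.⊔ (1 ℕ.⊓ ∣ Q ∣)
∣∪∣-capped []          []          = refl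
∣∪∣-capped (true ∷ P)  (b ∷ Q)     = ≡-sym (ℕP.⊔-absorbs-⊓ 1 ∣ b ∷ Q ∣)
∣∪∣-capped (false ∷ P) (true ∷ Q)  =
  ≡-sym (trans (ℕP.⊔-comm (1 ℕ.⊓ ∣ P ∣) 1) (ℕP.⊔-absorbs-⊓ 1 ∣ P ∣))
∣∪∣-capped (false ∷ P) (false ∷ Q) = ∣∪∣-capped P Q

neighEquiv-∪ : ∀ {n} (G : Graph n) {S X X' Y Y'} →
  NeighEquiv G 1 S X X' → NeighEquiv G 1 S Y Y' → NeighEquiv G 1 S (X ∪ Y) (X' ∪ Y')
neighEquiv-∪ G {X = X} {X'} {Y} {Y'} X≡X' Y≡Y' u u∉S = begin
  1 ℕ.⊓ ∣ (X ∪ Y) ∩ N G u ∣                                ≡⟨ capped-∪ X Y ⟩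
  (1 ℕ.⊓ ∣ X ∩ N G u ∣) ℕ.⊔ (1 ℕ.⊓ ∣ Y ∩ N G u ∣)      ≡⟨ cong₂ ℕ._⊔_ (X≡X' u u∉S) (Y≡Y' u u∉S) ⟩
  (1 ℕ.⊓ ∣ X' ∩ N G u ∣) ℕ.⊔ (1 ℕ.⊓ ∣ Y' ∩ N G u ∣)    ≡⟨ capped-∪ X' Y' ⟨
  1 ℕ.⊓ ∣ (X' ∪ Y') ∩ N G u ∣                              ∎
  where
  open ≡-Reasoning
  capped-∪ : ∀ P Q → 1 ℕ.⊓ ∣ (P ∪ Q) ∩ N G u ∣ ≡ (1 ℕ.⊓ ∣ P ∩ N G u ∣) ℕ.⊔ (1 ℕ.⊓ ∣ Q ∩ N G u ∣)
  capped-∪ P Q = trans (cong (λ Z → 1 ℕ.⊓ ∣ Z ∣) (∩-distribʳ-∪ (N G u) P Q))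
                       (∣∪∣-capped (P ∩ N G u) (Q ∩ N G u))

context-equiv : ∀ {n} (G : Graph n) {d} → d ≥ 1 → ∀ {p q c W B Y R' A'} →
  q ⊆ ∁ p → c ⊆ ∁ p →
  W ⊆ q → NeighEquiv G d q W B → Y ⊆ c → NeighEquiv G 1 c Y R' →
  NeighEquiv G d (∁ p) A' (B ∪ R') →
  (W ∪ Y) ⊆ ∁ p × NeighEquiv G 1 (∁ p) (W ∪ Y) A'
context-equiv G d≥1 {p} {q} {c} {W} {B} {Y} {R'} {A'} q⊆ c⊆ W⊆q W≡B Y⊆c Y≡R' A'≡BR' =
  inside , neighEquiv-trans G {X = W ∪ Y} {B ∪ R'} {A'} WY≡BR' (neighEquiv-sym G {X = A'} {B ∪ R'} A'≡¹BR')
  where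
  W≡¹B : NeighEquiv G 1 (∁ p) W B
  W≡¹B = neighEquiv-mono G {X = W} {B} q⊆ (neighEquiv-weaken G {X = W} {B} d≥1 W≡B)
  Y≡¹R' : NeighEquiv G 1 (∁ p) Y R'
  Y≡¹R' = neighEquiv-mono G {X = Y} {R'} c⊆ Y≡R'
  WY≡BR' : NeighEquiv G 1 (∁ p) (W ∪ Y) (B ∪ R')
  WY≡BR' = neighEquiv-∪ G {X = W} {B} {Y} {R'} W≡¹B Y≡¹R'
  A'≡¹BR' : NeighEquiv G 1 (∁ p) A' (B ∪ R')
  A'≡¹BR' = neighEquiv-weaken G {X = A'} {B ∪ R'} d≥1 A'≡BR'
  inside : (W ∪ Y) ⊆ ∁ p
  inside i∈ with x∈p∪q⁻ W Y i∈
  ... | inj₁ i∈W = q⊆ (W⊆q i∈W)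
  ... | inj₂ i∈Y = c⊆ (Y⊆c i∈Y)

multiplicity : ∀ {n} → Fin n → Tree n → ℕ
multiplicity u t = length (filter (u ≟_) (leafList t))

multiplicity-node2 : ∀ {n} (u : Fin n) l r →
  multiplicity u (node2 l r) ≡ multiplicity u l ℕ.+ multiplicity u r
multiplicity-node2 u l r =
  trans (cong length (filter-++ (u ≟_) (leafList l) (leafList r)))
        (length-++ (filter (u ≟_) (leafList l)))

multiplicity-left : ∀ {n} (u : Fin n) l r → multiplicity u l ℕ.≤ multiplicity u (node2 l r)
multiplicity-left u l r =
  ℕP.≤-trans (ℕP.m≤m+n _ _) (ℕP.≤-reflexive (≡-sym (multiplicity-node2 u l r)))

multiplicity-right : ∀ {n} (u : Fin n) l r → multiplicity u r ℕ.≤ multiplicity u (node2 l r)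
multiplicity-right u l r =
  ℕP.≤-trans (ℕP.m≤n+m _ _) (ℕP.≤-reflexive (≡-sym (multiplicity-node2 u l r)))

multiplicity-node : ∀ {n} (u : Fin n) {y t} → NodeOf y t → multiplicity u y ℕ.≤ multiplicity u t
multiplicity-node u root = ℕP.≤-refl
multiplicity-node u (in1 y∈t) = multiplicity-node u y∈t
multiplicity-node u (inl {l = l} {r} y∈l) = ℕP.≤-trans (multiplicity-node u y∈l) (multiplicity-left u l r)
multiplicity-node u (inr {l = l} {r} y∈r) = ℕP.≤-trans (multiplicity-node u y∈r) (multiplicity-right u l r)

∈-V-leaf : ∀ {n} {u v : Fin n} → u ∈ V (leaf v) → u ≡ v
∈-V-leaf {u = u} {v} u∈ with u ≟ v | trans (≡-sym (lookup∘tabulate (λ x → ⌊ x ≟ v ⌋) u)) ([]=⇒lookup u∈)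
... | yes u≡v | _ = u≡v
... | no _    | ()

multiplicity-pos : ∀ {n} (u : Fin n) t → u ∈ V t → 1 ℕ.≤ multiplicity u t
multiplicity-pos u (leaf v) u∈ with ∈-V-leaf u∈
... | refl with u ≟ u
...   | yes _   = ℕ.s≤s ℕ.z≤n
...   | no u≢u  = ⊥-elim (u≢u refl)
multiplicity-pos u (node1 t) u∈ = multiplicity-pos u t u∈
multiplicity-pos u (node2 l r) u∈ with x∈p∪q⁻ (V l) (V r) u∈
... | inj₁ u∈l = ℕP.≤-trans (multiplicity-pos u l u∈l) (multiplicity-left u l r)
... | inj₂ u∈r = ℕP.≤-trans (multiplicity-pos u r u∈r) (multiplicity-right u l r)

-- A vertex in both children would label two leaves of T.
children-disjoint : ∀ {n} {T a b : Tree n} → IsLayout T → NodeOf (node2 a b) T → V b ⊆ ∁ (V a)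
children-disjoint {T = T} {a} {b} layout ab∈T {u} u∈b = x∉p⇒x∈∁p λ u∈a → two≰one (begin
  2                                                   ≤⟨ ℕP.+-mono-≤ (multiplicity-pos u a u∈a) (multiplicity-pos u b u∈b) ⟩
  multiplicity u a ℕ.+ multiplicity u b               ≡⟨ multiplicity-node2 u a b ⟨
  multiplicity u (node2 a b)                          ≤⟨ multiplicity-node u ab∈T ⟩
  multiplicity u T                                    ≡⟨ layout u ⟩
  1                                                   ∎)
  where
  open ℕP.≤-Reasoning
  two≰one : ¬ (2 ℕ.≤ 1)
  two≰one (ℕ.s≤s ())

disjoint-sym : ∀ {n} {p q : Subset n} → q ⊆ ∁ p → p ⊆ ∁ q
disjoint-sym q⊆∁p u∈p = x∉p⇒x∈∁p λ u∈q → x∈∁p⇒x∉p (q⊆∁p u∈q) u∈p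

if-∨ : ∀ b c (q : ℚ) → (b ≡ true → c ≡ true → ⊥) →
  (if b ∨ c then q else ℚ.0ℚ) ≡ (if b then q else ℚ.0ℚ) ℚ.+ (if c then q else ℚ.0ℚ)
if-∨ true  true  q excl = ⊥-elim (excl refl refl)
if-∨ true  false q _    = ≡-sym (ℚP.+-identityʳ q)
if-∨ false true  q _    = ≡-sym (ℚP.+-identityˡ q)
if-∨ false false q _    = ≡-sym (ℚP.+-identityˡ ℚ.0ℚ)

weight-∪ : ∀ {n} (w : Fin n → ℚ) (X W : Subset n) → W ⊆ ∁ X →
  weight w (X ∪ W) ≡ weight w X ℚ.+ weight w W
weight-∪ w [] [] _ = ≡-sym (ℚP.+-identityˡ ℚ.0ℚ)
weight-∪ w (b ∷ X) (c ∷ W) W⊆∁X = begin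
  [b∨c] ℚ.+ weight w' (X ∪ W)
    ≡⟨ cong₂ ℚ._+_ (if-∨ b c (w zero) excl) (weight-∪ w' X W (drop-∷-⊆ W⊆∁X)) ⟩
  ([b] ℚ.+ [c]) ℚ.+ (weight w' X ℚ.+ weight w' W)
    ≡⟨ interchange [b] [c] (weight w' X) (weight w' W) ⟩
  ([b] ℚ.+ weight w' X) ℚ.+ ([c] ℚ.+ weight w' W) ∎
  where
  open ≡-Reasoning
  w' : Fin _ → ℚ
  w' i = w (suc i)
  [b] [c] [b∨c] : ℚ
  [b] = if b then w zero else ℚ.0ℚ
  [c] = if c then w zero else ℚ.0ℚ
  [b∨c] = if b ∨ c then w zero else ℚ.0ℚ
  excl : b ≡ true → c ≡ true → ⊥
  excl refl refl with W⊆∁X here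
  ... | ()

lemma4p6 : ∀ {n} (G : Graph n) (w : Fin n → ℚ) (o : Opt) (T : Tree n) → IsLayout T →
    ∀ (a b : Tree n) → NodeOf (node2 a b) T →
    ∀ (d : ℕ) → d ≥ 1 →
    ∀ (R R' : Subset n) → IsRep G d (V (node2 a b)) R → R' ⊆ ∁ (V (node2 a b)) →
    ∀ (A A' B B' : Subset n) →
    IsRep G d (V a) A → IsRep G d (∁ (V a)) A' →
    IsRep G d (V b) B → IsRep G d (∁ (V b)) B' →
    Compatible G d a b R R' A A' B B' →
    ∀ (𝒜 ℬ 𝒜' ℬ' : Family n) →
    (∀ X → 𝒜 X → X ⊆ V a) → (∀ X → 𝒜 X → NeighEquiv G d (V a) X A) →
    (∀ W → ℬ W → W ⊆ V b) → (∀ W → ℬ W → NeighEquiv G d (V b) W B) →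
    𝒜' ⊑ 𝒜 → Represents o G w a A' 𝒜' 𝒜 →
    ℬ' ⊑ ℬ → Represents o G w b B' ℬ' ℬ →
    Represents o G w (node2 a b) R' (𝒜' ⊗ ℬ') (𝒜 ⊗ ℬ)
lemma4p6 G w o T layout a b ab∈T d d≥1 R R' _ _ A A' B B' _ _ _ _ (_ , A'≡BR' , B'≡AR')
         𝒜 ℬ 𝒜' ℬ' 𝒜⊆Va 𝒜≡A ℬ⊆Vb ℬ≡B 𝒜'⊑𝒜 repA ℬ'⊑ℬ repB Y Y⊆out Y≡R' v =
  forward v , backward v
  where
  Vb⊆∁Va : V b ⊆ ∁ (V a)
  Vb⊆∁Va = children-disjoint layout ab∈T

  out⊆∁Va : ∁ (V a ∪ V b) ⊆ ∁ (V a)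
  out⊆∁Va = p⊆q⇒∁p⊇∁q (p⊆p∪q (V b))

  out⊆∁Vb : ∁ (V a ∪ V b) ⊆ ∁ (V b)
  out⊆∁Vb = p⊆q⇒∁p⊇∁q (q⊆p∪q (V a) (V b))

  -- Relative to W ∪ Y, 𝒜' represents 𝒜 because W ∪ Y ≡¹ A' over ∁ V_a.
  presA : ∀ W → ℬ W → BestPreserved o G w 𝒜 𝒜' (W ∪ Y)
  presA W W∈ v′ =
    let (WY⊆ , WY≡A') = context-equiv G d≥1 {B = B} {R' = R'} {A' = A'}
                          Vb⊆∁Va out⊆∁Va (ℬ⊆Vb W W∈) (ℬ≡B W W∈) Y⊆out Y≡R' A'≡BR'
    in proj₁ (repA (W ∪ Y) WY⊆ WY≡A' v′)

  presB : ∀ X → 𝒜 X → BestPreserved o G w ℬ ℬ' (X ∪ Y)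
  presB X X∈ v′ =
    let (XY⊆ , XY≡B') = context-equiv G d≥1 {B = A} {R' = R'} {A' = B'}
                          (disjoint-sym Vb⊆∁Va) out⊆∁Vb (𝒜⊆Va X X∈) (𝒜≡A X X∈) Y⊆out Y≡R' B'≡AR'
    in proj₁ (repB (X ∪ Y) XY⊆ XY≡B' v′)

  -- Members of 𝒜 and ℬ lie in the disjoint sets V_a and V_b.
  additive : ∀ X W → 𝒜 X → ℬ W → weight w (X ∪ W) ≡ weight w X ℚ.+ weight w W
  additive X W X∈ W∈ = weight-∪ w X W (p⊆q⇒∁p⊇∁q (𝒜⊆Va X X∈) ∘ Vb⊆∁Va ∘ ℬ⊆Vb W W∈)

  open Product o G w 𝒜 ℬ 𝒜' ℬ' Y 𝒜'⊑𝒜 ℬ'⊑ℬ presA presB additive
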